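{- The set of fully bounded cuttable $2$-permutations is closed under restriction: for any fully bounded cuttable $\sigma\in\mathrm{Perm}_2(n)$ and any $L\subseteq[n]$, the restriction $\sigma^{|L}$ is fully bounded cuttable.
   Context: A $2$-permutation of degree $n$ is a word on $\{1,1,2,2,\dots,n,n\}$; $\mathrm{Perm}_2(n)$ is their set. For $L=\{\ell_1<\dots<\ell_q\}\subseteq[n]$, $\sigma^{|L}$ keeps the letters of $\sigma$ in $L$ and replaces $\ell_x$ by $x$. $\gamma\in[n-1]$ is a bounded cut of $\sigma$ if $\sigma=f\mu\nu l$ where $f$ and $l$ are the first and last letters of $\sigma$, every letter of $\mu$ is at most $\gamma$, every letter of $\nu$ is greater than $\gamma$; $\sigma$ is bounded cuttable if it has a bounded cut; $\sigma$ is fully bounded cuttable if $\sigma^{|[a,b]}$ is bounded cuttable for every interval $[a,b]\subseteq[n]$ with $a<b$ (equivalently for every subset of size at least $2$). -}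

module Defs where

open import Data.Nat using (ℕ; zero; suc; _+_; _∸_; _≤_; _<_; _≤ᵇ_)
open import Data.Bool using (Bool; T; _∧_)
open import Data.Bool.Properties using (T?)
open import Data.List using (List; []; _∷_; _++_; [_]; map; filter; length; upTo)
open import Data.List.Relation.Unary.All using (All)
open import Data.Nat.Properties using (_≟_)
open import Data.Product using (Σ; ∃; _×_)
open import Relation.Binary.PropositionalEquality using (_≡_)

occ : ℕ → List ℕ → ℕ
occ x w = length (filter (x ≟_) w)

IsPerm2 : ℕ → List ℕ → Set
IsPerm2 n σ = All (λ x → 1 ≤ x × x ≤ n) σ × (∀ x → 1 ≤ x → x ≤ n → occ x σ ≡ 2)

Sub : Set
Sub = ℕ → Bool

oneTo : ℕ → List ℕ
oneTo v = map suc (upTo v)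

-- rank of v in L: number of elements of L in [1,v]; sends ℓ_x to x
rank : Sub → ℕ → ℕ
rank L v = length (filter (λ i → T? (L i)) (oneTo v))

restrict : Sub → List ℕ → List ℕ
restrict L σ = map (rank L) (filter (λ x → T? (L x)) σ)

-- |L ∩ [n]|: the degree of σ^{|L} when σ ∈ Perm₂(n)
deg : ℕ → Sub → ℕ
deg n L = rank L n

interval : ℕ → ℕ → Sub
interval a b x = (a ≤ᵇ x) ∧ (x ≤ᵇ b)

IsBoundedCut : ℕ → List ℕ → Set
IsBoundedCut γ σ =
  Σ ℕ λ f → Σ (List ℕ) λ μ → Σ (List ℕ) λ ν → Σ ℕ λ l →
    (σ ≡ f ∷ (μ ++ (ν ++ [ l ]))) × All (λ x → x ≤ γ) μ × All (λ x → γ < x) ν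

BoundedCuttable : ℕ → List ℕ → Set
BoundedCuttable n σ = Σ ℕ λ γ → 1 ≤ γ × γ < n × IsBoundedCut γ σ

FullyBoundedCuttable : ℕ → List ℕ → Set
FullyBoundedCuttable n σ =
  ∀ a b → 1 ≤ a → a < b → b ≤ n →
    BoundedCuttable (suc (b ∸ a)) (restrict (interval a b) σ)

-- Choose p < q in L of ranks a and b. The letters of (σ^{|L})^{|[a,b]} are those of
-- L ∩ [p,q], so up to an order-preserving renaming this word is a subword of σ^{|[p,q]},
-- which has a bounded cut γ. As p occurs twice in σ the subword has a first and a last
-- letter, its interior is a subword of the interior of σ^{|[p,q]}, and hence it is still
-- a block of letters ≤ γ followed by a block of letters > γ. The renaming is monotone
-- and strictly so on L ∩ [p,q], so it carries the cut to the image of the letter c of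
-- [p,q] of rank γ.
module Submission where

open import Defs
open import Data.Bool using (true; false; T; _∧_)
open import Data.Bool.Properties using (T?; T-∧)
open import Data.Empty using (⊥-elim)
open import Data.List using (List; []; _∷_; _++_; [_]; map; filter; length; upTo)
open import Data.List.Properties
  using ( map-++; length-map; length-++; length-++-≤ʳ; ++-assoc; ∷-injective; ∷ʳ-injective
        ; reverse-++; upTo-∷ʳ; filter-++)
open import Data.List.Relation.Binary.Sublist.Propositional using (_⊆_; []; _∷_; _∷ʳ_; ⊆-refl)
open import Data.List.Relation.Binary.Sublist.Propositional.Properties
  using (All-resp-⊆; map⁺; ∷⁻; reverse⁺; reverse⁻; filter⁺; length-mono-≤)
open import Data.List.Relation.Unary.All using (All; []; _∷_)
import Data.List.Relation.Unary.All as All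
import Data.List.Relation.Unary.All.Properties as AllP
open import Data.List.Reverse using (reverseView; []; _∶_∶ʳ_)
open import Data.Nat using (ℕ; zero; suc; _+_; _≤_; _<_; _≤′_; ≤′-refl; ≤′-step; _∸_; z≤n; s≤s; s≤s⁻¹)
open import Data.Nat.Properties
open import Data.Product using (∃; ∃₂; _×_; _,_; proj₁; proj₂)
open import Function using (_∘_; Equivalence)
open import Relation.Binary.PropositionalEquality
  using (_≡_; refl; sym; trans; cong; subst; subst₂; module ≡-Reasoning)
open import Relation.Nullary using (¬_; yes; no; contradiction)

select : Sub → List ℕ → List ℕ
select L = filter (λ x → T? (L x))

_⨾_ : Sub → Sub → Sub
(L ⨾ M) x = L x ∧ M (rank L x)

restrict-⨾ : ∀ L M σ → restrict M (restrict L σ) ≡ map (rank M ∘ rank L) (select (L ⨾ M) σ)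
restrict-⨾ L M [] = refl
restrict-⨾ L M (x ∷ σ) with L x
... | false = restrict-⨾ L M σ
... | true with M (rank L x)
...   | false = restrict-⨾ L M σ
...   | true = cong (rank M (rank L x) ∷_) (restrict-⨾ L M σ)

occ≤length-select : ∀ S {x} → T (S x) → ∀ σ → occ x σ ≤ length (select S σ)
occ≤length-select S Sx σ =
  length-mono-≤ (filter⁺ (_ ≟_) (λ y → T? (S y)) (λ { refl refl → Sx }) (⊆-refl {x = σ}))

rank-suc : ∀ L v → rank L (suc v) ≡ rank L v + length (select L [ suc v ])
rank-suc L v = begin
  length (select L (map suc (upTo (suc v))))       ≡⟨ cong (length ∘ select L ∘ map suc) (upTo-∷ʳ v) ⟨
  length (select L (map suc (upTo v ++ [ v ])))    ≡⟨ cong (length ∘ select L) (map-++ suc (upTo v) [ v ]) ⟩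
  length (select L (oneTo v ++ [ suc v ]))         ≡⟨ cong length (filter-++ _ (oneTo v) [ suc v ]) ⟩
  length (select L (oneTo v) ++ select L [ suc v ]) ≡⟨ length-++ (select L (oneTo v)) ⟩
  rank L v + length (select L [ suc v ])           ∎
  where open ≡-Reasoning

rank-suc-∈ : ∀ L {v} → T (L (suc v)) → rank L (suc v) ≡ suc (rank L v)
rank-suc-∈ L {v} Lv rewrite rank-suc L v with L (suc v)
... | true  = +-comm (rank L v) 1
... | false = ⊥-elim Lv

rank-suc-∉ : ∀ L {v} → ¬ T (L (suc v)) → rank L (suc v) ≡ rank L v
rank-suc-∉ L {v} ¬Lv rewrite rank-suc L v with L (suc v)
... | true  = contradiction _ ¬Lv
... | false = +-identityʳ (rank L v)

rank-mono : ∀ L {x y} → x ≤ y → rank L x ≤ rank L y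
rank-mono L = mono′ ∘ ≤⇒≤′
  where
  mono′ : ∀ {x y} → x ≤′ y → rank L x ≤ rank L y
  mono′ ≤′-refl = ≤-refl
  mono′ (≤′-step {n} x≤′n) =
    ≤-trans (mono′ x≤′n) (≤-trans (m≤m+n (rank L n) _) (≤-reflexive (sym (rank-suc L n))))

rank-strict : ∀ L {x y} → T (L y) → x < y → rank L x < rank L y
rank-strict L {x} {suc y} Ly (s≤s x≤y) =
  subst (rank L x <_) (sym (rank-suc-∈ L Ly)) (s≤s (rank-mono L x≤y))

rank-cancel-≤ : ∀ L {x y} → T (L x) → rank L x ≤ rank L y → x ≤ y
rank-cancel-≤ L Lx rx≤ry = ≮⇒≥ (λ y<x → <⇒≱ (rank-strict L Lx y<x) rx≤ry)

rank-cancel-< : ∀ L {x y} → rank L x < rank L y → x < y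
rank-cancel-< L rx<ry = ≰⇒> (λ y≤x → <⇒≱ rx<ry (rank-mono L y≤x))

rank-surjective : ∀ L n {k} → 1 ≤ k → k ≤ rank L n →
  ∃ λ v → 1 ≤ v × v ≤ n × T (L v) × rank L v ≡ k
rank-surjective L zero 1≤k k≤0 = contradiction k≤0 (<⇒≱ 1≤k)
rank-surjective L (suc n) {k} 1≤k k≤r with k ≤? rank L n
... | yes k≤r′ with rank-surjective L n 1≤k k≤r′
...   | v , 1≤v , v≤n , Lv , rv≡k = v , 1≤v , m≤n⇒m≤1+n v≤n , Lv , rv≡k
rank-surjective L (suc n) {k} 1≤k k≤r | no k≰r′ with T? (L (suc n))
... | yes Ln = suc n , s≤s z≤n , ≤-refl , Ln ,
               ≤-antisym (subst (_≤ k) (sym (rank-suc-∈ L Ln)) (≰⇒> k≰r′)) k≤r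
... | no ¬Ln = contradiction (subst (k ≤_) (rank-suc-∉ L ¬Ln) k≤r) k≰r′

interval⁺ : ∀ {a b x} → a ≤ x → x ≤ b → T (interval a b x)
interval⁺ a≤x x≤b = Equivalence.from T-∧ (≤⇒≤ᵇ a≤x , ≤⇒≤ᵇ x≤b)

interval⁻ : ∀ {a b x} → T (interval a b x) → a ≤ x × x ≤ b
interval⁻ {a} {b} {x} t with Equivalence.to T-∧ t
... | a≤ᵇx , x≤ᵇb = ≤ᵇ⇒≤ a x a≤ᵇx , ≤ᵇ⇒≤ x b x≤ᵇb

rank-interval : ∀ a b {x} → x ≤ b → rank (interval (suc a) b) x ≡ x ∸ a
rank-interval a b {zero} _ = sym (0∸n≡0 a)
rank-interval a b {suc x} 1+x≤b with a ≤? x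
... | yes a≤x = begin
  rank I (suc x) ≡⟨ rank-suc-∈ I (interval⁺ (s≤s a≤x) 1+x≤b) ⟩
  suc (rank I x) ≡⟨ cong suc (rank-interval a b (≤-trans (n≤1+n x) 1+x≤b)) ⟩
  suc (x ∸ a)    ≡⟨ +-∸-assoc 1 a≤x ⟨
  suc x ∸ a      ∎
  where open ≡-Reasoning
        I = interval (suc a) b
... | no a≰x = begin
  rank I (suc x) ≡⟨ rank-suc-∉ I (a≰x ∘ s≤s⁻¹ ∘ proj₁ ∘ interval⁻ {suc a} {b}) ⟩
  rank I x       ≡⟨ rank-interval a b (≤-trans (n≤1+n x) 1+x≤b) ⟩
  x ∸ a          ≡⟨ m≤n⇒m∸n≡0 (<⇒≤ x<a) ⟩
  0              ≡⟨ m≤n⇒m∸n≡0 x<a ⟨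
  suc x ∸ a      ∎
  where open ≡-Reasoning
        I = interval (suc a) b
        x<a = ≰⇒> a≰x

rank-interval-end : ∀ {a b} → 1 ≤ a → a ≤ b → rank (interval a b) b ≡ suc (b ∸ a)
rank-interval-end {suc a} {suc b} _ (s≤s a≤b) = trans (rank-interval a (suc b) ≤-refl) (+-∸-assoc 1 a≤b)

⨾⁺ : ∀ L M {x} → T (L x) → T (M (rank L x)) → T ((L ⨾ M) x)
⨾⁺ L M Lx Mx = Equivalence.from T-∧ (Lx , Mx)

⨾⁻ : ∀ L M {x} → T ((L ⨾ M) x) → T (L x) × T (M (rank L x))
⨾⁻ L M = Equivalence.to T-∧

rank-⨾-strict : ∀ L M {x y} → T ((L ⨾ M) y) → x < y → rank M (rank L x) < rank M (rank L y)
rank-⨾-strict L M t x<y with ⨾⁻ L M t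
... | Ly , My = rank-strict M My (rank-strict L Ly x<y)

⨾-interval⁻ : ∀ L {p q x} → T (L p) → T ((L ⨾ interval (rank L p) (rank L q)) x) → T (interval p q x)
⨾-interval⁻ L {p} {q} Lp t with ⨾⁻ L (interval (rank L p) (rank L q)) t
... | Lx , Irx with interval⁻ {rank L p} {rank L q} Irx
...   | rp≤rx , rx≤rq = interval⁺ (rank-cancel-≤ L Lp rp≤rx) (rank-cancel-≤ L Lx rx≤rq)

data LowHigh (γ : ℕ) : List ℕ → Set where
  high : ∀ {xs} → All (γ <_) xs → LowHigh γ xs
  low  : ∀ {x xs} → x ≤ γ → LowHigh γ xs → LowHigh γ (x ∷ xs)

lowHigh-++ : ∀ {γ xs ys} → All (_≤ γ) xs → All (γ <_) ys → LowHigh γ (xs ++ ys)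
lowHigh-++ [] ys>γ = high ys>γ
lowHigh-++ (x≤γ ∷ xs≤γ) ys>γ = low x≤γ (lowHigh-++ xs≤γ ys>γ)

lowHigh-split : ∀ {γ zs} → LowHigh γ zs →
  ∃₂ λ xs ys → zs ≡ xs ++ ys × All (_≤ γ) xs × All (γ <_) ys
lowHigh-split (high zs>γ) = [] , _ , refl , [] , zs>γ
lowHigh-split (low z≤γ lh) with lowHigh-split lh
... | xs , ys , refl , xs≤γ , ys>γ = _ ∷ xs , ys , refl , z≤γ ∷ xs≤γ , ys>γ

lowHigh-⊆ : ∀ {γ xs ys} → xs ⊆ ys → LowHigh γ ys → LowHigh γ xs
lowHigh-⊆ xs⊆ys (high ys>γ) = high (All-resp-⊆ xs⊆ys ys>γ)
lowHigh-⊆ (y ∷ʳ xs⊆ys) (low _ lh) = lowHigh-⊆ xs⊆ys lh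
lowHigh-⊆ (refl ∷ xs⊆ys) (low x≤γ lh) = low x≤γ (lowHigh-⊆ xs⊆ys lh)

SameSide : (ℕ → ℕ) → ℕ → (ℕ → ℕ) → ℕ → ℕ → Set
SameSide h γ k γ′ x = (h x ≤ γ → k x ≤ γ′) × (γ < h x → γ′ < k x)

lowHigh-map : ∀ {h k γ γ′} xs → All (SameSide h γ k γ′) xs →
  LowHigh γ (map h xs) → LowHigh γ′ (map k xs)
lowHigh-map [] _ _ = high []
lowHigh-map xs@(_ ∷ _) same (high hxs>γ) =
  high (AllP.map⁺ (All.zipWith (λ ((_ , >-case) , hx>γ) → >-case hx>γ) (same , AllP.map⁻ hxs>γ)))
lowHigh-map (x ∷ xs) ((≤-case , _) ∷ same) (low hx≤γ lh) = low (≤-case hx≤γ) (lowHigh-map xs same lh)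

frame : ∀ (u : List ℕ) → 2 ≤ length u → ∃₂ λ f m → ∃ λ l → u ≡ f ∷ m ++ [ l ]
frame (f ∷ u) (s≤s 1≤u) with reverseView u
... | []          = contradiction 1≤u λ ()
... | m ∶ _ ∶ʳ l = f , m , l , refl

⊆-interior : ∀ {f : ℕ} {m l f′ k l′} → f ∷ m ++ [ l ] ⊆ f′ ∷ k ++ [ l′ ] → m ⊆ k
⊆-interior {m = m} {l} {k = k} {l′} s =
  reverse⁻ (∷⁻ (subst₂ _⊆_ (reverse-++ m [ l ]) (reverse-++ k [ l′ ]) (reverse⁺ (∷⁻ s))))

isBoundedCut⁺ : ∀ {γ w f m l} → w ≡ f ∷ m ++ [ l ] → LowHigh γ m → IsBoundedCut γ w
isBoundedCut⁺ {f = f} {l = l} refl lh with lowHigh-split lh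
... | μ , ν , refl , μ≤γ , ν>γ = f , μ , ν , l , cong (f ∷_) (++-assoc μ ν [ l ]) , μ≤γ , ν>γ

isBoundedCut⁻ : ∀ {γ w} → IsBoundedCut γ w → ∃₂ λ f m → ∃ λ l → w ≡ f ∷ m ++ [ l ] × LowHigh γ m
isBoundedCut⁻ (f , μ , ν , l , refl , μ≤γ , ν>γ) =
  f , μ ++ ν , l , cong (f ∷_) (sym (++-assoc μ ν [ l ])) , lowHigh-++ μ≤γ ν>γ

isBoundedCut-length : ∀ {γ w} → IsBoundedCut γ w → 2 ≤ length w
isBoundedCut-length cut with isBoundedCut⁻ cut
... | _ , m , l , refl , _ = s≤s (length-++-≤ʳ [ l ] {m})

IsBoundedCut-⊆ : ∀ {γ u w} → u ⊆ w → 2 ≤ length u → IsBoundedCut γ w → IsBoundedCut γ u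
IsBoundedCut-⊆ {u = u} u⊆w 2≤u cut with frame u 2≤u
... | _ , _ , _ , refl with isBoundedCut⁻ cut
...   | _ , _ , _ , refl , lh = isBoundedCut⁺ refl (lowHigh-⊆ (⊆-interior u⊆w) lh)

IsBoundedCut-map : ∀ {h k γ γ′} u → All (SameSide h γ k γ′) u →
  IsBoundedCut γ (map h u) → IsBoundedCut γ′ (map k u)
IsBoundedCut-map {h} {k} u same cut
  with frame u (subst (2 ≤_) (length-map h u) (isBoundedCut-length cut)) | isBoundedCut⁻ cut
... | f , m , l , refl | _ , m′ , _ , hu≡ , lh
  with ∷ʳ-injective (map h m) m′ (trans (sym (map-++ h m [ l ])) (proj₂ (∷-injective hu≡)))
... | refl , _ =
  isBoundedCut⁺ (cong (k f ∷_) (map-++ k m [ l ])) (lowHigh-map m (AllP.++⁻ˡ m (All.tail same)) lh)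

BoundedCuttable-restrict-interval : ∀ {σ} L {p q} → T (L p) → T (L q) →
  1 ≤ p → p < q → 2 ≤ occ p σ →
  BoundedCuttable (suc (q ∸ p)) (restrict (interval p q) σ) →
  BoundedCuttable (suc (rank L q ∸ rank L p)) (restrict (interval (rank L p) (rank L q)) (restrict L σ))
BoundedCuttable-restrict-interval {σ} L {p} {q} Lp Lq 1≤p p<q 2≤occ (γ , 1≤γ , γ<deg , cut)
  with rank-surjective (interval p q) q 1≤γ
         (subst (γ ≤_) (sym (rank-interval-end 1≤p (<⇒≤ p<q))) (<⇒≤ γ<deg))
... | c , _ , _ , Wc , refl =
  k c , 1≤kc , kc<deg ,
  subst (IsBoundedCut (k c)) (sym (restrict-⨾ L I σ))
    (IsBoundedCut-map u (All.map sameSide (AllP.all-filter (λ x → T? (P x)) σ))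
      (IsBoundedCut-⊆ (map⁺ h u⊆w) 2≤hu cut))
  where
  W = interval p q
  I = interval (rank L p) (rank L q)
  P = L ⨾ I
  h = rank W
  k = rank I ∘ rank L
  u = select P σ

  rp≤rq : rank L p ≤ rank L q
  rp≤rq = rank-mono L (<⇒≤ p<q)

  u⊆w : u ⊆ select W σ
  u⊆w = filter⁺ (λ x → T? (P x)) (λ x → T? (W x)) (λ { refl Px → ⨾-interval⁻ L Lp Px })
                (⊆-refl {x = σ})

  2≤hu : 2 ≤ length (map h u)
  2≤hu = subst (2 ≤_) (sym (length-map h u))
           (≤-trans 2≤occ (occ≤length-select P (⨾⁺ L I Lp (interval⁺ ≤-refl rp≤rq)) σ))

  sameSide : ∀ {x} → T (P x) → SameSide h (h c) k (k c) x
  sameSide Px =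
      (λ hx≤hc → rank-mono I (rank-mono L (rank-cancel-≤ W {y = c} (⨾-interval⁻ L Lp Px) hx≤hc)))
    , (λ hc<hx → rank-⨾-strict L I Px (rank-cancel-< W {c} hc<hx))

  1≤kc : 1 ≤ k c
  1≤kc = ≤-trans (rank-strict I (interval⁺ ≤-refl rp≤rq) (rank-strict L Lp 1≤p))
                 (rank-mono I (rank-mono L (proj₁ (interval⁻ {p} {q} Wc))))

  kc<deg : k c < suc (rank L q ∸ rank L p)
  kc<deg = subst (k c <_) (rank-interval-end (rank-strict L Lp 1≤p) rp≤rq)
             (rank-strict I (interval⁺ rp≤rq ≤-refl) (rank-strict L Lq c<q))
    where c<q = rank-cancel-< W {c} {q}
                  (subst (h c <_) (sym (rank-interval-end 1≤p (<⇒≤ p<q))) γ<deg)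

theorem5p7 : (n : ℕ) (σ : List ℕ) (L : Sub) →
    IsPerm2 n σ → FullyBoundedCuttable n σ →
    FullyBoundedCuttable (deg n L) (restrict L σ)
theorem5p7 n σ L (_ , occ≡2) fbc a b 1≤a a<b b≤deg
  with rank-surjective L n 1≤a (≤-trans (<⇒≤ a<b) b≤deg)
     | rank-surjective L n (≤-trans 1≤a (<⇒≤ a<b)) b≤deg
... | p , 1≤p , p≤n , Lp , refl | q , _ , q≤n , Lq , refl =
  BoundedCuttable-restrict-interval {σ} L Lp Lq 1≤p p<q
    (≤-reflexive (sym (occ≡2 p 1≤p p≤n))) (fbc p q 1≤p p<q q≤n)
  where p<q = rank-cancel-< L {p} {q} a<b
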